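{- Let $k\ge0$, let $\mathcal{A}=\langle Q,q_0,\delta,F\rangle$ be a universal co-Büchi automaton over $\Upsilon\times\Gamma$, and let $\mathcal{S}_k=\langle S,\mathit{init},\tau,l\rangle$ be a $k$-lookahead transition system. Then $\mathcal{S}_k\models\mathcal{A}$ (i.e., every trace of $\mathcal{S}_k$ is accepted by $\mathcal{A}$) if and only if the run graph $\mathcal{S}_k\times\mathcal{A}$ is accepting.
   Context: $\Upsilon=2^I$, $\Gamma=2^O$ for disjoint finite sets $I,O$. A $k$-lookahead transition system $\mathcal{S}_k=\langle S,\mathit{init},\tau,l\rangle$ has finite state set $S$, initialization function $\mathit{init}\colon\Upsilon^k\to S$, transition function $\tau\colon S\times\Upsilon\to S$, and labeling $l\colon S\to\Gamma$: it observes the first $k$ inputs, chooses an initial state based on them, then progresses at the pace of the input. Formally, on input $\upsilon_0\upsilon_1\ldots\in\Upsilon^\omega$ its state sequence is $s_0=\mathit{init}(\upsilon_0\cdots\upsilon_{k-1})$, $s_{i+1}=\tau(s_i,\upsilon_{i+k})$, and its trace is $(\upsilon_0,l(s_0))(\upsilon_1,l(s_1))\ldots$. A universal co-Büchi automaton $\mathcal{A}=\langle Q,q_0,\delta,F\rangle$ has finite $Q$, $q_0\in Q$, rejecting states $F\subseteq Q$, $\delta\colon Q\times\Upsilon\times\Gamma\to2^Q$, and accepts a word $(\upsilon_0,\gamma_0)(\upsilon_1,\gamma_1)\ldots$ iff every infinite sequence $q_0q_1\ldots$ with $q_{i+1}\in\delta(q_i,\upsilon_i,\gamma_i)$ visits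 $F$ only finitely often. The run graph $\mathcal{S}_k\times\mathcal{A}$ has vertices $S\times Q\times\Upsilon^k$, initial vertices $(\mathit{init}(\vec\upsilon),q_0,\vec\upsilon)$ for every $\vec\upsilon\in\Upsilon^k$, and an edge from $(s,q,\upsilon_1\cdots\upsilon_k)$ to $(s',q',\upsilon'_1\cdots\upsilon'_k)$ iff there is $\upsilon_{k+1}\in\Upsilon$ with $s'=\tau(s,\upsilon_{k+1})$, $q'\in\delta(q,\upsilon_1,l(s))$, and $\upsilon'_i=\upsilon_{i+1}$ for $1\le i\le k$. It is accepting iff every infinite path starting in an initial vertex visits only finitely often vertices whose $Q$-component lies in $F$. -}

module Defs where

open import Data.Nat using (ℕ; zero; suc; _+_; _≤_)
open import Data.Fin using (Fin; toℕ)
open import Data.Fin.Subset using (Subset; _∈_; _∉_)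
open import Data.Vec using (Vec; tabulate; head; tail; _∷ʳ_)
open import Data.Product using (Σ; ∃; _×_; _,_; proj₁; proj₂)
open import Relation.Binary.PropositionalEquality using (_≡_)

-- Input letters Υ = 2^I and output letters Γ = 2^O, with |I| = nI, |O| = nO.
-- (I and O are separate index sets, hence disjoint.)
Υ : ℕ → Set
Υ nI = Subset nI

Γ : ℕ → Set
Γ nO = Subset nO

record LTS (nI nO k : ℕ) : Set where
  field
    nS   : ℕ
    init : Vec (Υ nI) k → Fin nS
    τ    : Fin nS → Υ nI → Fin nS
    l    : Fin nS → Γ nO

record UCB (nI nO : ℕ) : Set where
  field
    nQ : ℕ
    q₀ : Fin nQ
    δ  : Fin nQ → Υ nI → Γ nO → Subset nQ
    F  : Subset nQ

FinitelyOften : {n : ℕ} → Subset n → (ℕ → Fin n) → Set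
FinitelyOften F q = ∃ λ N → ∀ i → N ≤ i → q i ∉ F

module _ {nI nO : ℕ} where

  IsRun : (A : UCB nI nO) → (ℕ → Υ nI × Γ nO) → (ℕ → Fin (UCB.nQ A)) → Set
  IsRun A w q = (q 0 ≡ UCB.q₀ A)
              × (∀ i → q (suc i) ∈ UCB.δ A (q i) (proj₁ (w i)) (proj₂ (w i)))

  Accepts : (A : UCB nI nO) → (ℕ → Υ nI × Γ nO) → Set
  Accepts A w = ∀ q → IsRun A w q → FinitelyOften (UCB.F A) q

  module _ {k : ℕ} (S : LTS nI nO k) where
    open LTS S

    window : (ℕ → Υ nI) → ℕ → Vec (Υ nI) k
    window υ i = tabulate (λ j → υ (i + toℕ j))

    states : (ℕ → Υ nI) → ℕ → Fin nS
    states υ zero    = init (window υ 0)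
    states υ (suc i) = τ (states υ i) (υ (i + k))

    trace : (ℕ → Υ nI) → ℕ → Υ nI × Γ nO
    trace υ i = υ i , l (states υ i)

    Models : UCB nI nO → Set
    Models A = ∀ (υ : ℕ → Υ nI) → Accepts A (trace υ)

    module _ (A : UCB nI nO) where
      open UCB A

      Vertex : Set
      Vertex = Fin nS × Fin nQ × Vec (Υ nI) k

      vS : Vertex → Fin nS
      vS = proj₁

      vQ : Vertex → Fin nQ
      vQ v = proj₁ (proj₂ v)

      vW : Vertex → Vec (Υ nI) k
      vW v = proj₂ (proj₂ v)

      Initial : Vertex → Set
      Initial v = (vS v ≡ init (vW v)) × (vQ v ≡ q₀)

      -- edge (s,q,υ₁⋯υ_k) → (s',q',υ₂⋯υ_{k+1}) for some υ_{k+1}, with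
      -- s' = τ(s,υ_{k+1}), q' ∈ δ(q,υ₁,l(s)); υ₁ is the head of υ₁⋯υ_{k+1}.
      Edge : Vertex → Vertex → Set
      Edge v v' = Σ (Υ nI) λ u →
          (vS v' ≡ τ (vS v) u)
        × (vQ v' ∈ δ (vQ v) (head (vW v ∷ʳ u)) (l (vS v)))
        × (vW v' ≡ tail (vW v ∷ʳ u))

      IsPath : (ℕ → Vertex) → Set
      IsPath p = Initial (p 0) × (∀ i → Edge (p i) (p (suc i)))

      RunGraphAccepting : Set
      RunGraphAccepting = ∀ p → IsPath p → FinitelyOften F (λ i → vQ (p i))

module Submission where

-- Both sides quantify over infinite sequences
-- of automaton states and demand that they visit F finitely often, so it
-- suffices to translate, in both directions, between
--   * runs of A on traces of S (an input word υ plus a state sequence q), and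
--   * paths of the run graph (vertices (s, q, window of k upcoming inputs)),
-- preserving the sequence of automaton states.
-- A run yields the path whose i-th vertex is (sᵢ, qᵢ, υᵢ⋯υᵢ₊ₖ₋₁); conversely
-- a path determines its input word by reading the head of each extended
-- window.

open import Defs
open import Data.Nat using (ℕ; zero; suc; _+_)
open import Data.Nat.Properties using (+-suc; +-identityʳ)
open import Data.Fin using (Fin; toℕ; inject₁; fromℕ)
import Data.Fin as Fin
open import Data.Fin.Properties using (toℕ-inject₁; toℕ-fromℕ)
open import Data.Vec using (Vec; []; _∷_; tabulate; head; tail; _∷ʳ_; lookup)
open import Data.Vec.Properties using (tabulate-cong; tabulate∘lookup)
open import Data.Fin.Subset using (_∈_)
open import Data.Product using (_,_; proj₁; proj₂)
open import Function.Bundles using (_⇔_; mk⇔)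
open import Relation.Binary.PropositionalEquality
open ≡-Reasoning

private
  variable
    X : Set
    n : ℕ

lookup-∷ʳ-inject₁ : (xs : Vec X n) (x : X) (j : Fin n) →
                    lookup (xs ∷ʳ x) (inject₁ j) ≡ lookup xs j
lookup-∷ʳ-inject₁ (y ∷ xs) x Fin.zero    = refl
lookup-∷ʳ-inject₁ (y ∷ xs) x (Fin.suc j) = lookup-∷ʳ-inject₁ xs x j

lookup-∷ʳ-last : (xs : Vec X n) (x : X) → lookup (xs ∷ʳ x) (fromℕ n) ≡ x
lookup-∷ʳ-last []       x = refl
lookup-∷ʳ-last (y ∷ xs) x = lookup-∷ʳ-last xs x

head≡lookup-zero : (xs : Vec X (suc n)) → head xs ≡ lookup xs Fin.zero
head≡lookup-zero (x ∷ xs) = refl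

lookup-tail : (xs : Vec X (suc n)) (j : Fin n) → lookup (tail xs) j ≡ lookup xs (Fin.suc j)
lookup-tail (x ∷ xs) j = refl

tabulate-∷ʳ : (f : Fin n → X) (g : Fin (suc n) → X) (x : X) →
              (∀ j → g (inject₁ j) ≡ f j) → g (fromℕ n) ≡ x →
              tabulate f ∷ʳ x ≡ tabulate g
tabulate-∷ʳ {n = zero}  f g x agree last = cong (_∷ []) (sym last)
tabulate-∷ʳ {n = suc n} f g x agree last =
  cong₂ _∷_ (sym (agree Fin.zero))
            (tabulate-∷ʳ (λ j → f (Fin.suc j)) (λ j → g (Fin.suc j)) x
                         (λ j → agree (Fin.suc j)) last)

module Sliding {X : Set} (k : ℕ) where

  -- the k letters starting at position i (definitionally Defs.window)
  windowAt : (ℕ → X) → ℕ → Vec X k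
  windowAt υ i = tabulate (λ j → υ (i + toℕ j))

  windowAt-∷ʳ : (υ : ℕ → X) (i : ℕ) →
                windowAt υ i ∷ʳ υ (i + k) ≡ tabulate (λ (j : Fin (suc k)) → υ (i + toℕ j))
  windowAt-∷ʳ υ i = tabulate-∷ʳ _ (λ j → υ (i + toℕ j)) _
    (λ j → cong (λ m → υ (i + m)) (toℕ-inject₁ j))
    (cong (λ m → υ (i + m)) (toℕ-fromℕ k))

  slide-head : (υ : ℕ → X) (i : ℕ) → head (windowAt υ i ∷ʳ υ (i + k)) ≡ υ i
  slide-head υ i = trans (cong head (windowAt-∷ʳ υ i)) (cong υ (+-identityʳ i))

  slide-tail : (υ : ℕ → X) (i : ℕ) → tail (windowAt υ i ∷ʳ υ (i + k)) ≡ windowAt υ (suc i)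
  slide-tail υ i = trans (cong tail (windowAt-∷ʳ υ i))
                         (tabulate-cong (λ j → cong υ (+-suc i (toℕ j))))

  module Reading (w : ℕ → Vec X k) (u : ℕ → X)
                 (slides : ∀ i → w (suc i) ≡ tail (w i ∷ʳ u i)) where

    extended : ℕ → Vec X (suc k)
    extended i = w i ∷ʳ u i

    read : ℕ → X
    read i = head (extended i)

    diagonal : ∀ m i (j : Fin (suc k)) → toℕ j ≡ m → lookup (extended i) j ≡ read (i + m)
    diagonal zero i Fin.zero refl = begin
        lookup (extended i) Fin.zero  ≡⟨ sym (head≡lookup-zero (extended i)) ⟩
        read i                        ≡⟨ cong read (sym (+-identityʳ i)) ⟩
        read (i + zero)               ∎
    diagonal (suc m) i (Fin.suc j) refl = begin
        lookup (extended i) (Fin.suc j)                ≡⟨ sym (lookup-tail (extended i) j) ⟩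
        lookup (tail (extended i)) j                   ≡⟨ cong (λ v → lookup v j) (sym (slides i)) ⟩
        lookup (w (suc i)) j                           ≡⟨ sym (lookup-∷ʳ-inject₁ (w (suc i)) (u (suc i)) j) ⟩
        lookup (extended (suc i)) (inject₁ j)          ≡⟨ diagonal (toℕ j) (suc i) (inject₁ j) (toℕ-inject₁ j) ⟩
        read (suc i + toℕ j)                           ≡⟨ cong read (sym (+-suc i (toℕ j))) ⟩
        read (i + suc (toℕ j))                         ∎

    w≡windowAt : ∀ i → w i ≡ windowAt read i
    w≡windowAt i = begin
        w i                                          ≡⟨ sym (tabulate∘lookup (w i)) ⟩
        tabulate (lookup (w i))                      ≡⟨ tabulate-cong entry ⟩
        windowAt read i                              ∎
      where
        entry : ∀ j → lookup (w i) j ≡ read (i + toℕ j)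
        entry j = trans (sym (lookup-∷ʳ-inject₁ (w i) (u i) j))
                        (diagonal (toℕ j) i (inject₁ j) (toℕ-inject₁ j))

    u≡read : ∀ i → u i ≡ read (i + k)
    u≡read i = trans (sym (lookup-∷ʳ-last (w i) (u i)))
                     (diagonal k i (fromℕ k) (toℕ-fromℕ k))

module RunGraph {nI nO k : ℕ} (A : UCB nI nO) (S : LTS nI nO k) where
  open LTS S
  open UCB A
  open Sliding {X = Υ nI} k

  liftRun : (ℕ → Υ nI) → (ℕ → Fin nQ) → ℕ → Vertex S A
  liftRun υ q i = states S υ i , q i , window S υ i

  liftRun-isPath : (υ : ℕ → Υ nI) (q : ℕ → Fin nQ) →
                   IsRun A (trace S υ) q → IsPath S A (liftRun υ q)
  liftRun-isPath υ q (q0 , step) = (refl , q0) , edge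
    where
      edge : ∀ i → Edge S A (liftRun υ q i) (liftRun υ q (suc i))
      edge i = υ (i + k) , refl
             , subst (λ a → q (suc i) ∈ δ (q i) a (l (states S υ i)))
                     (sym (slide-head υ i)) (step i)
             , sym (slide-tail υ i)

  module _ (p : ℕ → Vertex S A) (path : IsPath S A p) where
    -- the windows along the path slide, appending the letter chosen by each edge
    private
      open module Windows = Reading (λ i → vW S A (p i)) (λ i → proj₁ (proj₂ path i))
                                    (λ i → proj₂ (proj₂ (proj₂ (proj₂ path i))))

    pathInput : ℕ → Υ nI
    pathInput = read

    states≡path : ∀ i → states S pathInput i ≡ vS S A (p i)
    states≡path zero = begin
        init (window S pathInput 0)  ≡⟨ cong init (sym (w≡windowAt 0)) ⟩
        init (vW S A (p 0))          ≡⟨ sym (proj₁ (proj₁ path)) ⟩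
        vS S A (p 0)                 ∎
    states≡path (suc i) = begin
        τ (states S pathInput i) (pathInput (i + k))  ≡⟨ cong₂ τ (states≡path i) (sym (u≡read i)) ⟩
        τ (vS S A (p i)) (proj₁ (proj₂ path i))       ≡⟨ sym (proj₁ (proj₂ (proj₂ path i))) ⟩
        vS S A (p (suc i))                            ∎

    projectPath-isRun : IsRun A (trace S pathInput) (λ i → vQ S A (p i))
    projectPath-isRun = proj₂ (proj₁ path) , step
      where
        step : ∀ i → vQ S A (p (suc i)) ∈ δ (vQ S A (p i)) (pathInput i) (l (states S pathInput i))
        step i = subst (λ s → vQ S A (p (suc i)) ∈ δ (vQ S A (p i)) (pathInput i) (l s))
                       (sym (states≡path i)) (proj₁ (proj₂ (proj₂ (proj₂ path i))))

lemma1 : {nI nO : ℕ} (k : ℕ) (A : UCB nI nO) (S : LTS nI nO k) →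
    Models S A ⇔ RunGraphAccepting S A
lemma1 k A S = mk⇔ models⇒accepting accepting⇒models
  where
    open RunGraph A S

    models⇒accepting : Models S A → RunGraphAccepting S A
    models⇒accepting M p path = M (pathInput p path) (λ i → vQ S A (p i)) (projectPath-isRun p path)

    accepting⇒models : RunGraphAccepting S A → Models S A
    accepting⇒models RG υ q run = RG (liftRun υ q) (liftRun-isPath υ q run)
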